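{- In System $\mathsf{F}_{<:}^{K\top}$, for every context $\Theta$ and types $S,T$ well-formed in $\Theta$: $\Theta\vdash S<:T$ if and only if $\Theta\vdash_A S<:T$.
   Context: System $\mathsf{F}_{<:}^{K\top}$. Raw types: $T ::= \top \mid X \mid T\to T \mid \forall^{K}(X<:T).T \mid \forall^{\top}(X<:T).T$ (up to $\alpha$-conversion). Contexts $\Theta$ are finite sequences of assumptions $X<:T$ (and $x:T$), with the usual well-formedness judgment $\Theta\vdash T$. The (declarative) subtyping relation $\Theta\vdash S<:T$ is generated by: (Var) $\Theta,X<:T,\Theta'\vdash X<:T$ (context well-formed); (Top) $\Theta\vdash T<:\top$; (Refl) $\Theta\vdash T<:T$; (Trans) from $\Theta\vdash T<:T'$ and $\Theta\vdash T'<:T''$ infer $\Theta\vdash T<:T''$; ($\to$) from $\Theta\vdash S'<:S$, $\Theta\vdash T<:T'$ infer $\Theta\vdash S\to T<:S'\to T'$; ($\forall$-Fun) from $\Theta,X<:S\vdash T<:T'$ infer $\Theta\vdash\forall^K(X<:S).T<:\forall^K(X<:S).T'$; ($\forall$-Loc) from $\Theta\vdash T_0<:S_0$ and $\Theta,X<:S_0\vdash S_1<:T_1$ infer $\Theta\vdash\forall^K(X<:S_0).S_1<:\forall^\top(X<:T_0).T_1$; ($\forall$-Top) from $\Theta\vdash T_0<:S_0$ and $\Theta,X<:\top\vdash S_1<:T_1$ infer $\Theta\vdash\forall^\top(X<:S_0).S_1<:\forall^\top(X<:T_0).T_1$. The algorithmic relation $\Theta\vdash_A S<:T$ is generated by: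 $\Theta\vdash_A T<:\top$ (for $\Theta\vdash T$); $\Theta\vdash_A X<:X$ (for $\Theta\vdash X$); if $\Theta=\Theta_1,X<:S,\Theta_2$ and $\Theta\vdash_A S<:T$ with $T\not\equiv\top$ and $T\not\equiv X$, then $\Theta\vdash_A X<:T$; from $\Theta\vdash_A S'<:S$ and $\Theta\vdash_A T<:T'$ infer $\Theta\vdash_A S\to T<:S'\to T'$; from $\Theta,X<:S\vdash_A T<:T'$ infer $\Theta\vdash_A\forall^K(X<:S).T<:\forall^K(X<:S).T'$; from $\Theta\vdash_A T_0<:S_0$ and $\Theta,X<:S_0\vdash_A S_1<:T_1$ infer $\Theta\vdash_A\forall^K(X<:S_0).S_1<:\forall^\top(X<:T_0).T_1$; from $\Theta\vdash_A T_0<:S_0$ and $\Theta,X<:\top\vdash_A S_1<:T_1$ infer $\Theta\vdash_A\forall^\top(X<:S_0).S_1<:\forall^\top(X<:T_0).T_1$. -}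

module Defs where

-- System F<:^{K⊤}, with types represented in well-scoped de Bruijn form
-- (this realises "raw types up to α-conversion").  A context of length n
-- binds n variables (type variables X<:T and term variables x:T); a type
-- that lives in scope n may mention any of the n bound names, and the
-- well-formedness judgment Θ ⊢ T checks that every variable used as a
-- type actually refers to a type-variable binding X<:T.

open import Data.Nat using (ℕ; zero; suc)
open import Data.Fin using (Fin; zero; suc)
open import Relation.Binary.PropositionalEquality using (_≡_)
open import Relation.Nullary using (¬_)

infixr 7 _⇒_

data Ty (n : ℕ) : Set where
  ⊤'  : Ty n
  var : Fin n → Ty n
  _⇒_ : Ty n → Ty n → Ty n
  ∀K  : Ty n → Ty (suc n) → Ty n
  ∀⊤  : Ty n → Ty (suc n) → Ty n

ext : ∀ {m n} → (Fin m → Fin n) → Fin (suc m) → Fin (suc n)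
ext ρ zero    = zero
ext ρ (suc i) = suc (ρ i)

rename : ∀ {m n} → (Fin m → Fin n) → Ty m → Ty n
rename ρ ⊤'       = ⊤'
rename ρ (var i)  = var (ρ i)
rename ρ (S ⇒ T)  = rename ρ S ⇒ rename ρ T
rename ρ (∀K S T) = ∀K (rename ρ S) (rename (ext ρ) T)
rename ρ (∀⊤ S T) = ∀⊤ (rename ρ S) (rename (ext ρ) T)

wk : ∀ {n} → Ty n → Ty (suc n)
wk = rename suc

infixl 5 _,<:_ _,∶_

data Ctx : ℕ → Set where
  ∅     : Ctx zero
  _,<:_ : ∀ {n} → Ctx n → Ty n → Ctx (suc n)
  _,∶_  : ∀ {n} → Ctx n → Ty n → Ctx (suc n)

-- Θ ∋ X <: T : the variable X is a type variable whose bound in Θ is T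
-- (weakened to the whole context Θ)
data _∋_<:_ : ∀ {n} → Ctx n → Fin n → Ty n → Set where
  here   : ∀ {n} {Θ : Ctx n} {T} → (Θ ,<: T) ∋ zero <: wk T
  thereT : ∀ {n} {Θ : Ctx n} {X T S} → Θ ∋ X <: T → (Θ ,<: S) ∋ suc X <: wk T
  therex : ∀ {n} {Θ : Ctx n} {X T S} → Θ ∋ X <: T → (Θ ,∶ S) ∋ suc X <: wk T

infix 4 _⊢_ ⊢_ _⊢_<:_ _⊢A_<:_

data _⊢_ {n} (Θ : Ctx n) : Ty n → Set where
  wf-top : Θ ⊢ ⊤'
  wf-var : ∀ {X U} → Θ ∋ X <: U → Θ ⊢ var X
  wf-arr : ∀ {S T} → Θ ⊢ S → Θ ⊢ T → Θ ⊢ S ⇒ T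
  wf-∀K  : ∀ {S T} → Θ ⊢ S → (Θ ,<: S) ⊢ T → Θ ⊢ ∀K S T
  wf-∀⊤  : ∀ {S T} → Θ ⊢ S → (Θ ,<: S) ⊢ T → Θ ⊢ ∀⊤ S T

data ⊢_ : ∀ {n} → Ctx n → Set where
  wf-∅   : ⊢ ∅
  wf-<:  : ∀ {n} {Θ : Ctx n} {T} → ⊢ Θ → Θ ⊢ T → ⊢ (Θ ,<: T)
  wf-∶   : ∀ {n} {Θ : Ctx n} {T} → ⊢ Θ → Θ ⊢ T → ⊢ (Θ ,∶ T)

data _⊢_<:_ {n} (Θ : Ctx n) : Ty n → Ty n → Set where
  S-Var   : ∀ {X T} → ⊢ Θ → Θ ∋ X <: T → Θ ⊢ var X <: T
  S-Top   : ∀ {T} → Θ ⊢ T <: ⊤'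
  S-Refl  : ∀ {T} → Θ ⊢ T <: T
  S-Trans : ∀ {T T′ T″} → Θ ⊢ T <: T′ → Θ ⊢ T′ <: T″ → Θ ⊢ T <: T″
  S-Arr   : ∀ {S S′ T T′} → Θ ⊢ S′ <: S → Θ ⊢ T <: T′ → Θ ⊢ S ⇒ T <: S′ ⇒ T′
  S-∀Fun  : ∀ {S T T′} → (Θ ,<: S) ⊢ T <: T′ → Θ ⊢ ∀K S T <: ∀K S T′
  S-∀Loc  : ∀ {S₀ S₁ T₀ T₁} → Θ ⊢ T₀ <: S₀ → (Θ ,<: S₀) ⊢ S₁ <: T₁
          → Θ ⊢ ∀K S₀ S₁ <: ∀⊤ T₀ T₁
  S-∀Top  : ∀ {S₀ S₁ T₀ T₁} → Θ ⊢ T₀ <: S₀ → (Θ ,<: ⊤') ⊢ S₁ <: T₁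
          → Θ ⊢ ∀⊤ S₀ S₁ <: ∀⊤ T₀ T₁

data _⊢A_<:_ {n} (Θ : Ctx n) : Ty n → Ty n → Set where
  A-Top   : ∀ {T} → Θ ⊢ T → Θ ⊢A T <: ⊤'
  A-Refl  : ∀ {X} → Θ ⊢ var X → Θ ⊢A var X <: var X
  A-Var   : ∀ {X S T} → Θ ∋ X <: S → Θ ⊢A S <: T
          → ¬ (T ≡ ⊤') → ¬ (T ≡ var X) → Θ ⊢A var X <: T
  A-Arr   : ∀ {S S′ T T′} → Θ ⊢A S′ <: S → Θ ⊢A T <: T′ → Θ ⊢A S ⇒ T <: S′ ⇒ T′
  A-∀Fun  : ∀ {S T T′} → (Θ ,<: S) ⊢A T <: T′ → Θ ⊢A ∀K S T <: ∀K S T′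
  A-∀Loc  : ∀ {S₀ S₁ T₀ T₁} → Θ ⊢A T₀ <: S₀ → (Θ ,<: S₀) ⊢A S₁ <: T₁
          → Θ ⊢A ∀K S₀ S₁ <: ∀⊤ T₀ T₁
  A-∀Top  : ∀ {S₀ S₁ T₀ T₁} → Θ ⊢A T₀ <: S₀ → (Θ ,<: ⊤') ⊢A S₁ <: T₁
          → Θ ⊢A ∀⊤ S₀ S₁ <: ∀⊤ T₀ T₁

module Submission where

-- Strip the well-formedness side conditions off the algorithmic rules; on
-- this relation reflexivity and transitivity are admissible, so every
-- declarative derivation can be translated into it.  The only delicate case
-- is transitivity through ∀⊤, which narrows the bound of X from ⊤ to an
-- arbitrary S₀.  That narrowing is free: a ⊤-bounded variable is never the
-- subject of a variable step, since its bound ⊤ has no supertype other than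
-- ⊤, and the variable rule excludes ⊤.  Well-formedness of Θ, S and T then
-- restores the side conditions (completeness), and S-Var with S-Trans
-- replays the stripped rules declaratively (soundness).

open import Defs
open import Data.Fin using (Fin; zero; suc)
open import Data.Fin.Properties using (_≟_)
open import Data.Product using (_×_; _,_; ∃)
open import Data.Sum using (_⊎_; inj₁; inj₂)
open import Data.Empty using (⊥-elim)
open import Relation.Nullary using (¬_; yes; no)
open import Relation.Binary.PropositionalEquality
  using (_≡_; refl; cong; cong₂; subst)

ext-id : ∀ {n} {ρ : Fin n → Fin n} → (∀ i → ρ i ≡ i) → ∀ i → ext ρ i ≡ i
ext-id ρ≗id zero    = refl
ext-id ρ≗id (suc i) = cong suc (ρ≗id i)

rename-id : ∀ {n} {ρ : Fin n → Fin n} → (∀ i → ρ i ≡ i) → ∀ T → rename ρ T ≡ T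
rename-id ρ≗id ⊤'       = refl
rename-id ρ≗id (var i)  = cong var (ρ≗id i)
rename-id ρ≗id (S ⇒ T)  = cong₂ _⇒_ (rename-id ρ≗id S) (rename-id ρ≗id T)
rename-id ρ≗id (∀K S T) = cong₂ ∀K (rename-id ρ≗id S) (rename-id (ext-id ρ≗id) T)
rename-id ρ≗id (∀⊤ S T) = cong₂ ∀⊤ (rename-id ρ≗id S) (rename-id (ext-id ρ≗id) T)

-- Well-formedness of a type only asks which variables are type variables,
-- not what their bounds are.
PreservesTyVars : ∀ {m n} → (Fin m → Fin n) → Ctx m → Ctx n → Set
PreservesTyVars {n = n} ρ Θ Δ = ∀ {X U} → Θ ∋ X <: U → ∃ λ (V : Ty n) → Δ ∋ ρ X <: V

preservesTyVars-ext : ∀ {m n} {ρ : Fin m → Fin n} {Θ Δ A B} →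
                      PreservesTyVars ρ Θ Δ → PreservesTyVars (ext ρ) (Θ ,<: A) (Δ ,<: B)
preservesTyVars-ext ρ-tv here = _ , here
preservesTyVars-ext ρ-tv (thereT X∈Θ) with ρ-tv X∈Θ
... | V , ρX∈Δ = wk V , thereT ρX∈Δ

wf-rename : ∀ {m n} {ρ : Fin m → Fin n} {Θ Δ T} →
            PreservesTyVars ρ Θ Δ → Θ ⊢ T → Δ ⊢ rename ρ T
wf-rename ρ-tv wf-top = wf-top
wf-rename ρ-tv (wf-var X∈Θ) with ρ-tv X∈Θ
... | _ , ρX∈Δ = wf-var ρX∈Δ
wf-rename ρ-tv (wf-arr wS wT) = wf-arr (wf-rename ρ-tv wS) (wf-rename ρ-tv wT)
wf-rename ρ-tv (wf-∀K wS wT) =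
  wf-∀K (wf-rename ρ-tv wS) (wf-rename (preservesTyVars-ext ρ-tv) wT)
wf-rename ρ-tv (wf-∀⊤ wS wT) =
  wf-∀⊤ (wf-rename ρ-tv wS) (wf-rename (preservesTyVars-ext ρ-tv) wT)

wf-rebound : ∀ {n} {Θ : Ctx n} {A B T} → (Θ ,<: A) ⊢ T → (Θ ,<: B) ⊢ T
wf-rebound {T = T} wT = subst (λ U → _ ⊢ U) (rename-id (λ _ → refl) T) (wf-rename rebound wT)
  where
  rebound : PreservesTyVars (λ i → i) _ _
  rebound here         = _ , here
  rebound (thereT X∈Θ) = _ , thereT X∈Θ

∋-wf : ∀ {n} {Θ : Ctx n} {X U} → ⊢ Θ → Θ ∋ X <: U → Θ ⊢ U
∋-wf (wf-<: ⊢Θ wT) here          = wf-rename (λ X∈Θ → _ , thereT X∈Θ) wT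
∋-wf (wf-<: ⊢Θ wT) (thereT X∈Θ) = wf-rename (λ Y∈Θ → _ , thereT Y∈Θ) (∋-wf ⊢Θ X∈Θ)
∋-wf (wf-∶ ⊢Θ wT)  (therex X∈Θ) = wf-rename (λ Y∈Θ → _ , therex Y∈Θ) (∋-wf ⊢Θ X∈Θ)

infix 4 _⊢M_<:_

data _⊢M_<:_ {n} (Θ : Ctx n) : Ty n → Ty n → Set where
  M-Top   : ∀ {T} → Θ ⊢M T <: ⊤'
  M-Refl  : ∀ {X} → Θ ⊢M var X <: var X
  M-Var   : ∀ {X S T} → Θ ∋ X <: S → Θ ⊢M S <: T
          → ¬ (T ≡ ⊤') → ¬ (T ≡ var X) → Θ ⊢M var X <: T
  M-Arr   : ∀ {S S′ T T′} → Θ ⊢M S′ <: S → Θ ⊢M T <: T′ → Θ ⊢M S ⇒ T <: S′ ⇒ T′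
  M-∀Fun  : ∀ {S T T′} → (Θ ,<: S) ⊢M T <: T′ → Θ ⊢M ∀K S T <: ∀K S T′
  M-∀Loc  : ∀ {S₀ S₁ T₀ T₁} → Θ ⊢M T₀ <: S₀ → (Θ ,<: S₀) ⊢M S₁ <: T₁
          → Θ ⊢M ∀K S₀ S₁ <: ∀⊤ T₀ T₁
  M-∀Top  : ∀ {S₀ S₁ T₀ T₁} → Θ ⊢M T₀ <: S₀ → (Θ ,<: ⊤') ⊢M S₁ <: T₁
          → Θ ⊢M ∀⊤ S₀ S₁ <: ∀⊤ T₀ T₁

A⇒M : ∀ {n} {Θ : Ctx n} {S T} → Θ ⊢A S <: T → Θ ⊢M S <: T
A⇒M (A-Top _)            = M-Top
A⇒M (A-Refl _)           = M-Refl
A⇒M (A-Var X∈Θ d T≢⊤ T≢X) = M-Var X∈Θ (A⇒M d) T≢⊤ T≢X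
A⇒M (A-Arr d e)          = M-Arr (A⇒M d) (A⇒M e)
A⇒M (A-∀Fun d)           = M-∀Fun (A⇒M d)
A⇒M (A-∀Loc d e)         = M-∀Loc (A⇒M d) (A⇒M e)
A⇒M (A-∀Top d e)         = M-∀Top (A⇒M d) (A⇒M e)

M⇒A : ∀ {n} {Θ : Ctx n} {S T} → ⊢ Θ → Θ ⊢ S → Θ ⊢ T → Θ ⊢M S <: T → Θ ⊢A S <: T
M⇒A ⊢Θ wS wT M-Top = A-Top wS
M⇒A ⊢Θ wS wT M-Refl = A-Refl wS
M⇒A ⊢Θ wS wT (M-Var X∈Θ d T≢⊤ T≢X) = A-Var X∈Θ (M⇒A ⊢Θ (∋-wf ⊢Θ X∈Θ) wT d) T≢⊤ T≢X
M⇒A ⊢Θ (wf-arr wS wT) (wf-arr wS′ wT′) (M-Arr d e) =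
  A-Arr (M⇒A ⊢Θ wS′ wS d) (M⇒A ⊢Θ wT wT′ e)
M⇒A ⊢Θ (wf-∀K wS wT) (wf-∀K _ wT′) (M-∀Fun d) = A-∀Fun (M⇒A (wf-<: ⊢Θ wS) wT wT′ d)
M⇒A ⊢Θ (wf-∀K wS₀ wS₁) (wf-∀⊤ wT₀ wT₁) (M-∀Loc d e) =
  A-∀Loc (M⇒A ⊢Θ wT₀ wS₀ d) (M⇒A (wf-<: ⊢Θ wS₀) wS₁ (wf-rebound wT₁) e)
M⇒A ⊢Θ (wf-∀⊤ wS₀ wS₁) (wf-∀⊤ wT₀ wT₁) (M-∀Top d e) =
  A-∀Top (M⇒A ⊢Θ wT₀ wS₀ d)
         (M⇒A (wf-<: ⊢Θ wf-top) (wf-rebound wS₁) (wf-rebound wT₁) e)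

M⇒D : ∀ {n} {Θ : Ctx n} {S T} → ⊢ Θ → Θ ⊢ S → Θ ⊢ T → Θ ⊢M S <: T → Θ ⊢ S <: T
M⇒D ⊢Θ wS wT M-Top = S-Top
M⇒D ⊢Θ wS wT M-Refl = S-Refl
M⇒D ⊢Θ wS wT (M-Var X∈Θ d _ _) = S-Trans (S-Var ⊢Θ X∈Θ) (M⇒D ⊢Θ (∋-wf ⊢Θ X∈Θ) wT d)
M⇒D ⊢Θ (wf-arr wS wT) (wf-arr wS′ wT′) (M-Arr d e) =
  S-Arr (M⇒D ⊢Θ wS′ wS d) (M⇒D ⊢Θ wT wT′ e)
M⇒D ⊢Θ (wf-∀K wS wT) (wf-∀K _ wT′) (M-∀Fun d) = S-∀Fun (M⇒D (wf-<: ⊢Θ wS) wT wT′ d)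
M⇒D ⊢Θ (wf-∀K wS₀ wS₁) (wf-∀⊤ wT₀ wT₁) (M-∀Loc d e) =
  S-∀Loc (M⇒D ⊢Θ wT₀ wS₀ d) (M⇒D (wf-<: ⊢Θ wS₀) wS₁ (wf-rebound wT₁) e)
M⇒D ⊢Θ (wf-∀⊤ wS₀ wS₁) (wf-∀⊤ wT₀ wT₁) (M-∀Top d e) =
  S-∀Top (M⇒D ⊢Θ wT₀ wS₀ d)
         (M⇒D (wf-<: ⊢Θ wf-top) (wf-rebound wS₁) (wf-rebound wT₁) e)

M-refl : ∀ {n} {Θ : Ctx n} T → Θ ⊢M T <: T
M-refl ⊤'       = M-Top
M-refl (var X)  = M-Refl
M-refl (S ⇒ T)  = M-Arr (M-refl S) (M-refl T)
M-refl (∀K S T) = M-∀Fun (M-refl T)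
M-refl (∀⊤ S T) = M-∀Top (M-refl S) (M-refl T)

M-var : ∀ {n} {Θ : Ctx n} {X U T} → Θ ∋ X <: U → Θ ⊢M U <: T → Θ ⊢M var X <: T
M-var {X = X} {T = ⊤'} X∈Θ d = M-Top
M-var {X = X} {T = var Y} X∈Θ d with Y ≟ X
... | yes refl = M-Refl
... | no Y≢X   = M-Var X∈Θ d (λ ()) λ { refl → Y≢X refl }
M-var {T = _ ⇒ _}  X∈Θ d = M-Var X∈Θ d (λ ()) (λ ())
M-var {T = ∀K _ _} X∈Θ d = M-Var X∈Θ d (λ ()) (λ ())
M-var {T = ∀⊤ _ _} X∈Θ d = M-Var X∈Θ d (λ ()) (λ ())

M-⊤-inv : ∀ {n} {Θ : Ctx n} {T} → Θ ⊢M ⊤' <: T → T ≡ ⊤'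
M-⊤-inv M-Top = refl

Narrows : ∀ {n} → Ctx n → Ctx n → Set
Narrows Δ Γ = ∀ {X U} → Δ ∋ X <: U → (U ≡ ⊤') ⊎ (Γ ∋ X <: U)

narrows-ext : ∀ {n} {Δ Γ : Ctx n} {A} → Narrows Δ Γ → Narrows (Δ ,<: A) (Γ ,<: A)
narrows-ext Δ⊑Γ here = inj₂ here
narrows-ext Δ⊑Γ (thereT X∈Δ) with Δ⊑Γ X∈Δ
... | inj₁ U≡⊤ = inj₁ (cong wk U≡⊤)
... | inj₂ X∈Γ = inj₂ (thereT X∈Γ)

narrows-⊤ : ∀ {n} {Θ : Ctx n} {A} → Narrows (Θ ,<: ⊤') (Θ ,<: A)
narrows-⊤ here         = inj₁ refl
narrows-⊤ (thereT X∈Θ) = inj₂ (thereT X∈Θ)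

M-narrow : ∀ {n} {Δ Γ : Ctx n} {S T} → Narrows Δ Γ → Δ ⊢M S <: T → Γ ⊢M S <: T
M-narrow Δ⊑Γ M-Top = M-Top
M-narrow Δ⊑Γ M-Refl = M-Refl
M-narrow Δ⊑Γ (M-Var X∈Δ d T≢⊤ T≢X) with Δ⊑Γ X∈Δ
... | inj₁ refl = ⊥-elim (T≢⊤ (M-⊤-inv d))
... | inj₂ X∈Γ = M-Var X∈Γ (M-narrow Δ⊑Γ d) T≢⊤ T≢X
M-narrow Δ⊑Γ (M-Arr d e)  = M-Arr (M-narrow Δ⊑Γ d) (M-narrow Δ⊑Γ e)
M-narrow Δ⊑Γ (M-∀Fun d)   = M-∀Fun (M-narrow (narrows-ext Δ⊑Γ) d)
M-narrow Δ⊑Γ (M-∀Loc d e) = M-∀Loc (M-narrow Δ⊑Γ d) (M-narrow (narrows-ext Δ⊑Γ) e)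
M-narrow Δ⊑Γ (M-∀Top d e) = M-∀Top (M-narrow Δ⊑Γ d) (M-narrow (narrows-ext Δ⊑Γ) e)

-- Recursion on the middle type Q: the narrowed derivation in the ∀⊤ case
-- is not a subterm.
M-trans : ∀ {n} {Θ : Ctx n} {S T} Q → Θ ⊢M S <: Q → Θ ⊢M Q <: T → Θ ⊢M S <: T
M-trans Q (M-Var X∈Θ d _ _) e = M-var X∈Θ (M-trans Q d e)
M-trans ⊤' M-Top M-Top = M-Top
M-trans (var X) M-Refl e = e
M-trans (Q₁ ⇒ Q₂) (M-Arr d₁ d₂) M-Top = M-Top
M-trans (Q₁ ⇒ Q₂) (M-Arr d₁ d₂) (M-Arr e₁ e₂) =
  M-Arr (M-trans Q₁ e₁ d₁) (M-trans Q₂ d₂ e₂)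
M-trans (∀K Q₁ Q₂) (M-∀Fun d) M-Top = M-Top
M-trans (∀K Q₁ Q₂) (M-∀Fun d) (M-∀Fun e) = M-∀Fun (M-trans Q₂ d e)
M-trans (∀K Q₁ Q₂) (M-∀Fun d) (M-∀Loc e₁ e₂) = M-∀Loc e₁ (M-trans Q₂ d e₂)
M-trans (∀⊤ Q₁ Q₂) (M-∀Loc d₁ d₂) M-Top = M-Top
M-trans (∀⊤ Q₁ Q₂) (M-∀Loc d₁ d₂) (M-∀Top e₁ e₂) =
  M-∀Loc (M-trans Q₁ e₁ d₁) (M-trans Q₂ d₂ (M-narrow narrows-⊤ e₂))
M-trans (∀⊤ Q₁ Q₂) (M-∀Top d₁ d₂) M-Top = M-Top
M-trans (∀⊤ Q₁ Q₂) (M-∀Top d₁ d₂) (M-∀Top e₁ e₂) =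
  M-∀Top (M-trans Q₁ e₁ d₁) (M-trans Q₂ d₂ e₂)

D⇒M : ∀ {n} {Θ : Ctx n} {S T} → Θ ⊢ S <: T → Θ ⊢M S <: T
D⇒M (S-Var _ X∈Θ)  = M-var X∈Θ (M-refl _)
D⇒M S-Top          = M-Top
D⇒M S-Refl         = M-refl _
D⇒M (S-Trans d e)  = M-trans _ (D⇒M d) (D⇒M e)
D⇒M (S-Arr d e)    = M-Arr (D⇒M d) (D⇒M e)
D⇒M (S-∀Fun d)     = M-∀Fun (D⇒M d)
D⇒M (S-∀Loc d e)   = M-∀Loc (D⇒M d) (D⇒M e)
D⇒M (S-∀Top d e)   = M-∀Top (D⇒M d) (D⇒M e)

mainTheorem5 : ∀ {n} (Θ : Ctx n) (S T : Ty n) → ⊢ Θ → Θ ⊢ S → Θ ⊢ T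
             → (Θ ⊢ S <: T → Θ ⊢A S <: T) × (Θ ⊢A S <: T → Θ ⊢ S <: T)
mainTheorem5 Θ S T ⊢Θ wS wT =
  (λ d → M⇒A ⊢Θ wS wT (D⇒M d)) , (λ d → M⇒D ⊢Θ wS wT (A⇒M d))
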